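{- For every positive integer $n$, the quasisymmetric Schur function $\mathcal{S}_{(2,1^n)}$ is not a symmetric function, i.e. $\mathcal{S}_{(2,1^n)}\notin\mathsf{Sym}$.
   Context: $\mathsf{QSym}$ is the algebra of quasisymmetric functions over $\mathbb{Q}$, with monomial basis $M_\beta=\sum_{i_1<\cdots<i_{\ell(\beta)}}x_{i_1}^{\beta_1}\cdots x_{i_{\ell(\beta)}}^{\beta_{\ell(\beta)}}$ indexed by integer compositions $\beta$; $\mathsf{Sym}\subseteq\mathsf{QSym}$ is the subalgebra of symmetric functions. $(2,1^n)$ denotes the composition $(2,1,\dots,1)$ with $n$ ones. The quasisymmetric Schur function indexed by a composition $\alpha$ is $\mathcal{S}_\alpha=\sum_\beta K_{\alpha,\beta}M_\beta$, where $K_{\alpha,\beta}$ is the number of fillings $T$ of the diagram of shape $\alpha$ (row $i$, counted from the top, has $\alpha_i$ cells, left-justified) with positive integers in which entry value $i$ occurs $\beta_i$ times, such that: each row is weakly decreasing from left to right; the first column is strictly increasing from top to bottom; and, letting $m$ be the largest part of $\alpha$ and $\hat T$ the $\ell(\alpha)\times m$ array obtained by filling the empty positions with $0$, for all $1\le i<j\le\ell(\alpha)$ and $2\le k\le m$: if $\hat T(j,k)\ne0$ and $\hat T(j,k)\ge\hat T(i,k)$ then $\hat T(j,k)>\hat T(i,k-1)$. -}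

module Defs where

open import Data.Bool using (Bool; true; false; _∧_; _∨_; not; if_then_else_)
open import Data.Nat using (ℕ; zero; suc; _≤ᵇ_; _<ᵇ_; _≡ᵇ_; _⊔_; _∸_)
open import Data.List using (List; []; _∷_; [_]; map; concat; concatMap; length; upTo; filterᵇ; foldr)
open import Data.List.Relation.Unary.All using (All)
open import Data.List.Relation.Binary.Permutation.Propositional using (_↭_)
open import Relation.Binary.PropositionalEquality using (_≡_)
open import Data.Nat using (_≤_)

all : {A : Set} → (A → Bool) → List A → Bool
all p xs = foldr _∧_ true (map p xs)

IsComposition : List ℕ → Set
IsComposition β = All (λ x → 1 ≤ x) β

lookupD : {A : Set} → List A → ℕ → A → A
lookupD []       _       d = d
lookupD (x ∷ xs) zero    d = x
lookupD (x ∷ xs) (suc i) d = lookupD xs i d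

-- A filling is a list of rows (top row first); each row is a list of entries.
Filling : Set
Filling = List (List ℕ)

-- T̂(i,k), 0-indexed rows i and columns k, with 0 in empty positions.
That : Filling → ℕ → ℕ → ℕ
That T i k = lookupD (lookupD T i []) k 0

weaklyDecreasing : List ℕ → Bool
weaklyDecreasing []           = true
weaklyDecreasing (x ∷ [])     = true
weaklyDecreasing (x ∷ y ∷ r)  = (y ≤ᵇ x) ∧ weaklyDecreasing (y ∷ r)

strictlyIncreasing : List ℕ → Bool
strictlyIncreasing []          = true
strictlyIncreasing (x ∷ [])    = true
strictlyIncreasing (x ∷ y ∷ r) = (x <ᵇ y) ∧ strictlyIncreasing (y ∷ r)

count : ℕ → List ℕ → ℕ
count v xs = length (filterᵇ (v ≡ᵇ_) xs)

shapeOK : Filling → List ℕ → Bool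
shapeOK []      []      = true
shapeOK (r ∷ T) (a ∷ α) = (length r ≡ᵇ a) ∧ shapeOK T α
shapeOK _       _       = false

contentOK : Filling → List ℕ → Bool
contentOK T β =
  all (λ x → (1 ≤ᵇ x) ∧ (x ≤ᵇ length β)) (concat T)
  ∧ all (λ i → count (suc i) (concat T) ≡ᵇ lookupD β i 0) (upTo (length β))

firstColumnOK : Filling → Bool
firstColumnOK T = strictlyIncreasing (map (λ r → lookupD r 0 0) T)

maxPart : List ℕ → ℕ
maxPart = foldr _⊔_ 0

-- triple condition: for 0-indexed rows i < j < ℓ(α) and 0-indexed columns
-- 1 ≤ k ≤ m-1 (i.e. 2 ≤ k ≤ m in 1-indexed terms):
-- if T̂(j,k) ≠ 0 and T̂(j,k) ≥ T̂(i,k) then T̂(j,k) > T̂(i,k-1).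
tripleOK : Filling → List ℕ → Bool
tripleOK T α =
  all (λ j → all (λ i → all (λ k →
        let t = That T j (suc k) in
        not (not (t ≡ᵇ 0) ∧ (That T i (suc k) ≤ᵇ t)) ∨ (That T i k <ᵇ t))
      (upTo (maxPart α ∸ 1)))
    (upTo j))
  (upTo (length α))

validFilling : List ℕ → List ℕ → Filling → Bool
validFilling α β T =
  shapeOK T α ∧ contentOK T β ∧ all weaklyDecreasing T ∧ firstColumnOK T ∧ tripleOK T α

-- Finite enumeration of all arrays of shape α with entries in {1,…,k}
-- (without repetition); a superset of the valid fillings of content β when k = ℓ(β).
rowsOf : ℕ → ℕ → List (List ℕ)
rowsOf zero    k = [ [] ]
rowsOf (suc l) k = concatMap (λ v → map (v ∷_) (rowsOf l k)) (map suc (upTo k))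

fillingsOf : List ℕ → ℕ → List Filling
fillingsOf []      k = [ [] ]
fillingsOf (a ∷ α) k = concatMap (λ r → map (r ∷_) (fillingsOf α k)) (rowsOf a k)

K : List ℕ → List ℕ → ℕ
K α β = length (filterᵇ (validFilling α β) (fillingsOf α (length β)))

-- An element of QSym, given by its coefficients in the monomial basis
-- (f = Σ_β f(β) M_β, β ranging over compositions).  Coefficients of 𝒮_α are in ℕ.
QSymCoeffs : Set
QSymCoeffs = List ℕ → ℕ

qsSchur : List ℕ → QSymCoeffs
qsSchur α = K α

-- f = Σ c_β M_β is symmetric iff it is invariant under permuting variables,
-- i.e. the coefficient of x^a depends only on the multiset of exponents,
-- i.e. c_β = c_γ whenever γ is a rearrangement of the composition β.
IsSymmetric : QSymCoeffs → Set
IsSymmetric f = ∀ β γ → IsComposition β → β ↭ γ → f β ≡ f γ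

{-# OPTIONS --safe #-}
-- Filling row i of the diagram of α with the value i gives a valid filling of content α, so
-- K_{α,α} ≥ 1 for every composition α.  When ℓ(α) = ℓ(β), the first column of a
-- valid filling is a strictly increasing sequence of ℓ values in {1,…,ℓ}, hence
-- starts with 1; the first row decreases weakly, so it consists of 1s and
-- α₁ ≤ β₁.  For α = (2,1ⁿ) and its rearrangement γ = (1,2,1ⁿ⁻¹) this gives
-- K_{α,γ} = 0 < K_{α,α}, while a symmetric function has equal coefficients on
-- M_α and M_γ.
module Submission where

open import Defs
open import Data.Nat using (ℕ; _≤_)
open import Data.List using (_∷_; replicate)
open import Relation.Nullary using (¬_)

open import Data.Bool using (T; _∧_; _∨_; not)
open import Data.Bool.Properties using (T-∧; T-∨)
open import Data.Empty using (⊥-elim)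
open import Data.Nat using (zero; suc; _+_; _∸_; _<_; z≤n; s≤s; s≤s⁻¹; z<s; _≤ᵇ_; _<ᵇ_; _≡ᵇ_)
open import Data.Nat.Properties
  using (≡ᵇ⇒≡; ≡⇒≡ᵇ; ≤ᵇ⇒≤; ≤⇒≤ᵇ; <ᵇ⇒<; <⇒<ᵇ; ≤-refl; ≤-reflexive; ≤-trans; ≤-antisym;
         <-irrefl; 1+n≰n; ≤-<-trans; <⇒≢; <⇒≤; <-≤-trans; n<1+n; m<m+n; m≤m+n;
         +-suc; +-identityʳ; +-monoˡ-≤; +-monoʳ-<; +-cancelʳ-≤; module ≤-Reasoning)
open import Data.List using (List; []; _++_; map; concat; length; upTo; filterᵇ)
open import Data.List.Properties
  using (length-++; length-map; length-replicate; filter-++; filter-all; filter-none; filter-some)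
open import Data.List.Relation.Unary.All as All using (All; []; _∷_)
open import Data.List.Relation.Unary.All.Properties
  using (all⁺; all⁻; applyUpTo⁺₁; applyUpTo⁺₂; ++⁺; ++⁻; ++⁻ˡ; concat⁻; map⁺; replicate⁺)
open import Data.List.Relation.Unary.Any using (here)
open import Data.List.Membership.Propositional using (_∈_; lose)
open import Data.List.Membership.Propositional.Properties using (∈-map⁺; ∈-concatMap⁺; ∈-upTo⁺)
open import Data.List.Relation.Binary.Permutation.Propositional using (swap; refl)
open import Data.Product using (_×_; _,_; proj₁; proj₂)
open import Data.Sum as Sum using (_⊎_; inj₁; inj₂; [_,_]′)
open import Function using (_∘_; id)
open import Function.Bundles using (Equivalence)
open import Relation.Binary.PropositionalEquality
  using (_≡_; _≢_; refl; sym; trans; cong; cong₂; subst; module ≡-Reasoning)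
open import Relation.Nullary.Decidable using (T?)

∧-split : ∀ x {y} → T (x ∧ y) → T x × T y
∧-split _ = Equivalence.to T-∧

∧-join : ∀ {x y} → T x → T y → T (x ∧ y)
∧-join p q = Equivalence.from T-∧ (p , q)

count-++ : ∀ v xs ys → count v (xs ++ ys) ≡ count v xs + count v ys
count-++ v xs ys =
  trans (cong length (filter-++ (T? ∘ (v ≡ᵇ_)) xs ys)) (length-++ (filterᵇ (v ≡ᵇ_) xs))

count-all : ∀ {v xs} → All (_≡ v) xs → count v xs ≡ length xs
count-all {v} all≡v =
  cong length (filter-all (T? ∘ (v ≡ᵇ_)) (All.map (λ {x} x≡v → ≡⇒≡ᵇ v x (sym x≡v)) all≡v))

count-none : ∀ {v xs} → All (_≢ v) xs → count v xs ≡ 0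
count-none {v} all≢v =
  cong length (filter-none (T? ∘ (v ≡ᵇ_)) (All.map (λ {x} x≢v t → x≢v (sym (≡ᵇ⇒≡ v x t))) all≢v))

lookupD-replicate : ∀ {A : Set} a (x : A) k d →
                    lookupD (replicate a x) k d ≡ d ⊎ lookupD (replicate a x) k d ≡ x
lookupD-replicate zero    x k       d = inj₁ refl
lookupD-replicate (suc a) x zero    d = inj₂ refl
lookupD-replicate (suc a) x (suc k) d = lookupD-replicate a x k d

weaklyDecreasing-replicate : ∀ a x → T (weaklyDecreasing (replicate a x))
weaklyDecreasing-replicate zero          x = _
weaklyDecreasing-replicate (suc zero)    x = _
weaklyDecreasing-replicate (suc (suc a)) x =
  ∧-join (≤⇒≤ᵇ (≤-refl {x})) (weaklyDecreasing-replicate (suc a) x)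

firstEntry : List ℕ → ℕ
firstEntry r = lookupD r 0 0

firstEntry≤ : ∀ {B} r → All (_≤ B) r → firstEntry r ≤ B
firstEntry≤ []      []      = z≤n
firstEntry≤ (x ∷ r) (x≤B ∷ _) = x≤B

weaklyDecreasing⇒≤firstEntry : ∀ r → T (weaklyDecreasing r) → All (_≤ firstEntry r) r
weaklyDecreasing⇒≤firstEntry []          _   = []
weaklyDecreasing⇒≤firstEntry (x ∷ [])    _   = ≤-refl ∷ []
weaklyDecreasing⇒≤firstEntry (x ∷ y ∷ r) dec =
  let y≤x , dec′ = ∧-split (y ≤ᵇ x) dec in
  ≤-refl ∷ All.map (λ z≤y → ≤-trans z≤y (≤ᵇ⇒≤ y x y≤x)) (weaklyDecreasing⇒≤firstEntry (y ∷ r) dec′)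

strictlyIncreasing⇒+length≤ : ∀ {B} x xs → T (strictlyIncreasing (x ∷ xs)) → All (_≤ B) (x ∷ xs) →
                              x + length xs ≤ B
strictlyIncreasing⇒+length≤ x []       _   (x≤B ∷ []) = subst (_≤ _) (sym (+-identityʳ x)) x≤B
strictlyIncreasing⇒+length≤ {B} x (y ∷ ys) inc (_ ∷ ≤B) =
  let x<y , inc′ = ∧-split (x <ᵇ y) inc in
  subst (_≤ B) (sym (+-suc x (length ys)))
    (≤-trans (+-monoˡ-≤ (length ys) (<ᵇ⇒< x y x<y)) (strictlyIncreasing⇒+length≤ y ys inc′ ≤B))

shapeOK⇒length≡ : ∀ F α → T (shapeOK F α) → length F ≡ length α
shapeOK⇒length≡ []      []      _     = refl
shapeOK⇒length≡ (r ∷ F) (a ∷ α) shape =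
  cong suc (shapeOK⇒length≡ F α (proj₂ (∧-split (length r ≡ᵇ a) shape)))

InRange : ℕ → ℕ → Set
InRange k x = 1 ≤ x × x ≤ k

record IsValidFilling (α β : List ℕ) (F : Filling) : Set where
  field
    shape          : T (shapeOK F α)
    entriesInRange : All (InRange (length β)) (concat F)
    content        : ∀ {i} → i < length β → count (suc i) (concat F) ≡ lookupD β i 0
    rowsDecreasing : All (T ∘ weaklyDecreasing) F
    firstColumn    : T (firstColumnOK F)
    triple         : T (tripleOK F α)

validFilling⇒IsValidFilling : ∀ α β F → T (validFilling α β F) → IsValidFilling α β F
validFilling⇒IsValidFilling α β F valid
  with shape       , valid₁ ← ∧-split (shapeOK F α) valid
  with contentOK′  , valid₂ ← ∧-split (contentOK F β) valid₁
  with inRange     , counts ← ∧-split (all (λ x → (1 ≤ᵇ x) ∧ (x ≤ᵇ length β)) (concat F)) contentOK′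
  with decreasing  , valid₃ ← ∧-split (all weaklyDecreasing F) valid₂
  with firstColumn , triple ← ∧-split (firstColumnOK F) valid₃
  = record
  { shape          = shape
  ; entriesInRange = All.map (λ {x} p → let lo , hi = ∧-split (1 ≤ᵇ x) p in ≤ᵇ⇒≤ 1 x lo , ≤ᵇ⇒≤ x _ hi)
                             (all⁺ _ (concat F) inRange)
  ; content        = λ i<ℓ → ≡ᵇ⇒≡ _ _ (All.lookup (all⁺ _ (upTo (length β)) counts) (∈-upTo⁺ i<ℓ))
  ; rowsDecreasing = all⁺ weaklyDecreasing F decreasing
  ; firstColumn    = firstColumn
  ; triple         = triple
  }

IsValidFilling⇒validFilling : ∀ {α β F} → IsValidFilling α β F → T (validFilling α β F)
IsValidFilling⇒validFilling {α} {β} {F} valid =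
  ∧-join shape (∧-join (∧-join inRange counts)
    (∧-join (all⁻ weaklyDecreasing rowsDecreasing) (∧-join firstColumn triple)))
  where
  open IsValidFilling valid
  inRange : T (all (λ x → (1 ≤ᵇ x) ∧ (x ≤ᵇ length β)) (concat F))
  inRange = all⁻ _ (All.map (λ (lo , hi) → ∧-join (≤⇒≤ᵇ lo) (≤⇒≤ᵇ hi)) entriesInRange)
  counts : T (all (λ i → count (suc i) (concat F) ≡ᵇ lookupD β i 0) (upTo (length β)))
  counts = all⁻ _ (applyUpTo⁺₁ _ (length β) (λ i<ℓ → ≡⇒≡ᵇ _ _ (content i<ℓ)))

∈-rowsOf : ∀ {k} r → All (InRange k) r → r ∈ rowsOf (length r) k
∈-rowsOf []          []                    = here refl
∈-rowsOf (suc v ∷ r) ((_ , v<k) ∷ inRange) =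
  ∈-concatMap⁺ _ (lose (∈-map⁺ suc (∈-upTo⁺ v<k)) (∈-map⁺ (suc v ∷_) (∈-rowsOf r inRange)))

∈-fillingsOf : ∀ {k} α F → T (shapeOK F α) → All (InRange k) (concat F) → F ∈ fillingsOf α k
∈-fillingsOf []      []      _     _ = here refl
∈-fillingsOf (a ∷ α) (r ∷ F) shape inRange
  with length≡ , shapeF ← ∧-split (length r ≡ᵇ a) shape
  with inRangeR , inRangeF ← ++⁻ r inRange
  = ∈-concatMap⁺ _ (lose r∈rowsOf (∈-map⁺ (r ∷_) (∈-fillingsOf α F shapeF inRangeF)))
  where
  r∈rowsOf : r ∈ rowsOf a _
  r∈rowsOf = subst (λ l → r ∈ rowsOf l _) (≡ᵇ⇒≡ (length r) a length≡) (∈-rowsOf r inRangeR)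

K-positive : ∀ {α β F} → IsValidFilling α β F → 0 < K α β
K-positive {α} {β} {F} valid =
  filter-some (T? ∘ validFilling α β) {fillingsOf α (length β)}
    (lose (∈-fillingsOf α F shape entriesInRange) (IsValidFilling⇒validFilling valid))
  where open IsValidFilling valid

K≡0 : ∀ {α β} → (∀ F → ¬ IsValidFilling α β F) → K α β ≡ 0
K≡0 {α} {β} noFilling =
  cong length (filter-none (T? ∘ validFilling α β)
    (All.universal (λ F → noFilling F ∘ validFilling⇒IsValidFilling α β F) (fillingsOf α (length β))))

tripleOK-intro : ∀ F α → (∀ {i j} k → i < j → That F j (suc k) ≡ 0 ⊎ That F i k < That F j (suc k)) →
                 T (tripleOK F α)
tripleOK-intro F α triple =
  all⁻ _ (applyUpTo⁺₂ id (length α) λ j →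
    all⁻ _ (applyUpTo⁺₁ id j λ {i} i<j →
      all⁻ _ (applyUpTo⁺₂ id (maxPart α ∸ 1) λ k → holds {a = That F i (suc k)} (triple k i<j))))
  where
  holds : ∀ {t a b} → t ≡ 0 ⊎ b < t → T (not (not (t ≡ᵇ 0) ∧ (a ≤ᵇ t)) ∨ (b <ᵇ t))
  holds (inj₁ refl) = _
  holds (inj₂ b<t)  = Equivalence.from T-∨ (inj₂ (<⇒<ᵇ b<t))

firstRow≡1 : ∀ {a α β r F} → length (a ∷ α) ≡ length β → IsValidFilling (a ∷ α) β (r ∷ F) →
             All (_≡ 1) r
firstRow≡1 {a} {α} {β} {r} {F} ℓα≡ℓβ valid =
  All.zipWith (λ (x≤first , (1≤x , _)) → ≤-antisym (≤-trans x≤first first≤1) 1≤x)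
    (weaklyDecreasing⇒≤firstEntry r (All.head rowsDecreasing) , ++⁻ˡ r entriesInRange)
  where
  open IsValidFilling valid
  firstColumnBounded : All (_≤ length β) (map firstEntry (r ∷ F))
  firstColumnBounded =
    map⁺ (All.map (λ {row} → firstEntry≤ row ∘ All.map proj₂) (concat⁻ entriesInRange))
  length≡ : length (map firstEntry F) ≡ length α
  length≡ =
    trans (length-map firstEntry F) (shapeOK⇒length≡ F α (proj₂ (∧-split (length r ≡ᵇ a) shape)))
  first≤1 : firstEntry r ≤ 1
  first≤1 = +-cancelʳ-≤ (length α) (firstEntry r) 1 (begin
    firstEntry r + length α                    ≡⟨ cong (firstEntry r +_) length≡ ⟨
    firstEntry r + length (map firstEntry F)   ≤⟨ strictlyIncreasing⇒+length≤ _ _ firstColumn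
                                                                                firstColumnBounded ⟩
    length β                                   ≡⟨ ℓα≡ℓβ ⟨
    1 + length α                               ∎)
    where open ≤-Reasoning

firstPart≤firstContent : ∀ {a b α β F} → length α ≡ length β → IsValidFilling (a ∷ α) (b ∷ β) F →
                         a ≤ b
firstPart≤firstContent {F = []} _ valid = ⊥-elim (IsValidFilling.shape valid)
firstPart≤firstContent {a} {b} {α} {β} {r ∷ F} ℓα≡ℓβ valid = begin
  a                               ≡⟨ ≡ᵇ⇒≡ (length r) a (proj₁ (∧-split (length r ≡ᵇ a) shape)) ⟨
  length r                        ≡⟨ count-all (firstRow≡1 (cong suc ℓα≡ℓβ) valid) ⟨
  count 1 r                       ≤⟨ m≤m+n (count 1 r) (count 1 (concat F)) ⟩
  count 1 r + count 1 (concat F)  ≡⟨ count-++ 1 r (concat F) ⟨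
  count 1 (concat (r ∷ F))        ≡⟨ content z<s ⟩
  b                               ∎
  where
  open IsValidFilling valid
  open ≤-Reasoning

rowIndexFilling : ℕ → List ℕ → Filling
rowIndexFilling v []      = []
rowIndexFilling v (a ∷ α) = replicate a v ∷ rowIndexFilling (suc v) α

shapeOK-rowIndexFilling : ∀ v α → T (shapeOK (rowIndexFilling v α) α)
shapeOK-rowIndexFilling v []      = _
shapeOK-rowIndexFilling v (a ∷ α) =
  ∧-join (≡⇒≡ᵇ _ a (length-replicate a)) (shapeOK-rowIndexFilling (suc v) α)

rowIndexFilling-entries : ∀ v α →
                          All (λ x → v ≤ x × x < v + length α) (concat (rowIndexFilling v α))
rowIndexFilling-entries v []      = []
rowIndexFilling-entries v (a ∷ α) =
  ++⁺ (replicate⁺ a (≤-refl , m<m+n v z<s))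
      (All.map (λ {x} (v<x , x<) → <⇒≤ v<x , subst (x <_) (sym (+-suc v (length α))) x<)
               (rowIndexFilling-entries (suc v) α))

count-rowIndexFilling-< : ∀ {u v} α → u < v → count u (concat (rowIndexFilling v α)) ≡ 0
count-rowIndexFilling-< {u} {v} α u<v =
  count-none (All.map (λ (v≤x , _) x≡u → <-irrefl (sym x≡u) (<-≤-trans u<v v≤x))
                      (rowIndexFilling-entries v α))

count-rowIndexFilling : ∀ v α i → count (v + i) (concat (rowIndexFilling v α)) ≡ lookupD α i 0
count-rowIndexFilling v []      i       = refl
count-rowIndexFilling v (a ∷ α) zero    = begin
  count (v + 0) (replicate a v ++ rest)   ≡⟨ cong (λ u → count u (replicate a v ++ rest)) (+-identityʳ v) ⟩
  count v (replicate a v ++ rest)         ≡⟨ count-++ v (replicate a v) rest ⟩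
  count v (replicate a v) + count v rest  ≡⟨ cong₂ _+_ (count-all (replicate⁺ a refl))
                                                        (count-rowIndexFilling-< α (n<1+n v)) ⟩
  length (replicate a v) + 0              ≡⟨ +-identityʳ _ ⟩
  length (replicate a v)                  ≡⟨ length-replicate a ⟩
  a                                       ∎
  where
  rest : List ℕ
  rest = concat (rowIndexFilling (suc v) α)
  open ≡-Reasoning
count-rowIndexFilling v (a ∷ α) (suc i) = begin
  count (v + suc i) (replicate a v ++ rest)                   ≡⟨ count-++ (v + suc i) (replicate a v) rest ⟩
  count (v + suc i) (replicate a v) + count (v + suc i) rest  ≡⟨ cong (_+ _) (count-none v≢) ⟩
  count (v + suc i) rest                                      ≡⟨ cong (λ u → count u rest) (+-suc v i) ⟩
  count (suc v + i) rest                                      ≡⟨ count-rowIndexFilling (suc v) α i ⟩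
  lookupD α i 0                                               ∎
  where
  rest : List ℕ
  rest = concat (rowIndexFilling (suc v) α)
  open ≡-Reasoning
  v≢ : All (_≢ v + suc i) (replicate a v)
  v≢ = replicate⁺ a (<⇒≢ (m<m+n v z<s))

rowsDecreasing-rowIndexFilling : ∀ v α → All (T ∘ weaklyDecreasing) (rowIndexFilling v α)
rowsDecreasing-rowIndexFilling v []      = []
rowsDecreasing-rowIndexFilling v (a ∷ α) =
  weaklyDecreasing-replicate a v ∷ rowsDecreasing-rowIndexFilling (suc v) α

firstColumnOK-rowIndexFilling : ∀ v α → IsComposition α → T (firstColumnOK (rowIndexFilling v α))
firstColumnOK-rowIndexFilling v []                  _                = _
firstColumnOK-rowIndexFilling v (a ∷ [])            _                = _
firstColumnOK-rowIndexFilling v (suc a ∷ suc b ∷ α) (_ ∷ composition) =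
  ∧-join (<⇒<ᵇ (n<1+n v)) (firstColumnOK-rowIndexFilling (suc v) (suc b ∷ α) composition)
firstColumnOK-rowIndexFilling v (suc a ∷ zero ∷ α)  (_ ∷ () ∷ _)

That-rowIndexFilling : ∀ v α j k →
                       That (rowIndexFilling v α) j k ≡ 0 ⊎ That (rowIndexFilling v α) j k ≡ v + j
That-rowIndexFilling v []      j       k = inj₁ refl
That-rowIndexFilling v (a ∷ α) zero    k =
  Sum.map₂ (λ e → trans e (sym (+-identityʳ v))) (lookupD-replicate a v k 0)
That-rowIndexFilling v (a ∷ α) (suc j) k =
  Sum.map₂ (λ e → trans e (sym (+-suc v j))) (That-rowIndexFilling (suc v) α j k)

tripleOK-rowIndexFilling : ∀ v α → T (tripleOK (rowIndexFilling v α) α)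
tripleOK-rowIndexFilling v α = tripleOK-intro (rowIndexFilling v α) α λ {i} {j} k i<j →
  Sum.map₂ (λ t≡ → subst (That (rowIndexFilling v α) i k <_) (sym t≡)
                         (≤-<-trans (That≤ i k) (+-monoʳ-< v i<j)))
           (That-rowIndexFilling v α j (suc k))
  where
  That≤ : ∀ i k → That (rowIndexFilling v α) i k ≤ v + i
  That≤ i k = [ (λ e → subst (_≤ v + i) (sym e) z≤n) , ≤-reflexive ]′ (That-rowIndexFilling v α i k)

rowIndexFilling-valid : ∀ α → IsComposition α → IsValidFilling α α (rowIndexFilling 1 α)
rowIndexFilling-valid α composition = record
  { shape          = shapeOK-rowIndexFilling 1 α
  ; entriesInRange = All.map (λ (1≤x , x<1+ℓ) → 1≤x , s≤s⁻¹ x<1+ℓ) (rowIndexFilling-entries 1 α)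
  ; content        = λ {i} _ → count-rowIndexFilling 1 α i
  ; rowsDecreasing = rowsDecreasing-rowIndexFilling 1 α
  ; firstColumn    = firstColumnOK-rowIndexFilling 1 α composition
  ; triple         = tripleOK-rowIndexFilling 1 α
  }

mainTheorem4 : ∀ (n : ℕ) → 1 ≤ n → ¬ IsSymmetric (qsSchur (2 ∷ replicate n 1))
mainTheorem4 zero    ()
mainTheorem4 (suc m) _ symmetric =
  <-irrefl (sym Kαα≡0) (K-positive (rowIndexFilling-valid α α-composition))
  where
  α γ : List ℕ
  α = 2 ∷ replicate (suc m) 1
  γ = 1 ∷ 2 ∷ replicate m 1
  α-composition : IsComposition α
  α-composition = s≤s z≤n ∷ replicate⁺ (suc m) ≤-refl
  Kαα≡0 : K α α ≡ 0
  Kαα≡0 = begin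
    K α α  ≡⟨ symmetric α γ α-composition (swap 2 1 refl) ⟩
    K α γ  ≡⟨ K≡0 {α} {γ} (λ F valid → 1+n≰n (firstPart≤firstContent refl valid)) ⟩
    0      ∎
    where open ≡-Reasoning
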